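{- Let $\sigma$ be a homogeneous ordering in which North is the smallest direction. Then the tree $T_{\boldsymbol{D}'}$ is a super-tree of $T_{\boldsymbol{D}_H}$ and a subtree of $T_{\mathrm{saw}}^\sigma(\mathbb{Z}^2)$ (as sets of walks from the origin).
   Context: Steps: $N=(0,1),S=(0,-1),E=(1,0),W=(-1,0)$. An ordering $\sigma=(\sigma_v)$ gives each $v\in\mathbb{Z}^2$ a total order $\sigma_v$ on its four neighbours; it is homogeneous if one total order on $\{N,E,S,W\}$ orders the neighbours $v+d$ of every $v$ by the order of $d$. $T_{\mathrm{saw}}(\mathbb{Z}^2)$: rooted tree of walks $(v_0,\dots,v_m)$ from the origin $v_0$ with $v_0,\dots,v_{m-1}$ distinct, $v_m\ne v_{m-2}$, and either $v_m$ new or $v_m=v_i$ for some $i$ (leaves); parent = walk minus last step. A leaf $(v_0,\dots,v_i=w,v_{i+1},\dots,v_{m-1},v_m=w)$ is labelled unoccupied if $v_{i+1}>v_{m-1}$ in $\sigma_w$, occupied if $v_{i+1}<v_{m-1}$ in $\sigma_w$; $T_{\mathrm{saw}}^\sigma(\mathbb{Z}^2)$ deletes unoccupied leaves and, for each occupied leaf, its parent with the whole subtree below. Trees generated by state rules: the root (origin) has state $O$; a vertex in a state has one child for each listed state, the child being the walk extended by the step given by the last letter of the child's state name. $T_{\boldsymbol{D}_H}$: $O\to N|E|W$, $N\to N|E|W$, $E\to N|E$, $W\to N|W$. $T_{\boldsymbol{D}'}$: $O\to N|E|W$; $N\to E|W|NN$; $E\to N|E$; $W\to N|W$; $NN\to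 NN|NNE|NNW$; $NNE\to N|NEE$; $NEE\to N|E|EES$; $EES\to ESE$; $ESE\to SEE$; $SEE\to EEN$; $EEN\to N|E$; $NNW\to N|NWW$; $NWW\to N|W|WWS$; $WWS\to WSW$; $WSW\to SWW$; $SWW\to WWN$; $WWN\to N|W$. -}

module Defs where

open import Data.Nat using (ℕ; zero; suc; _<_; _≤_; _∸_; _+_)
open import Data.Integer using (ℤ; 0ℤ; 1ℤ; -1ℤ) renaming (_+_ to _+ℤ_)
open import Data.Product using (Σ; ∃; ∃-syntax; _×_; _,_)
open import Data.Sum using (_⊎_)
open import Data.List using (List; []; _∷_; take; length; _∷ʳ_)
open import Data.List.Membership.Propositional using (_∈_)
open import Relation.Nullary using (¬_)
open import Relation.Binary.PropositionalEquality using (_≡_; _≢_)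
open import Relation.Binary.Definitions using ()
open import Relation.Binary.Structures using (IsStrictTotalOrder)
open import Function.Bundles using (_⇔_)

Pt : Set
Pt = ℤ × ℤ

_+ᵖ_ : Pt → Pt → Pt
(a , b) +ᵖ (c , d) = (a +ℤ c , b +ℤ d)

origin : Pt
origin = (0ℤ , 0ℤ)

data Dir : Set where
  N S E W : Dir

vec : Dir → Pt
vec N = (0ℤ , 1ℤ)
vec S = (0ℤ , -1ℤ)
vec E = (1ℤ , 0ℤ)
vec W = (-1ℤ , 0ℤ)

-- Walks from the origin, represented by their list of steps.
-- The walk (v₀,…,v_m) has v₀ = origin and v_k = pos ws k.

endpoint : List Dir → Pt
endpoint []       = origin
endpoint (d ∷ ds) = vec d +ᵖ endpoint ds

pos : List Dir → ℕ → Pt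
pos ws k = endpoint (take k ws)

-- Orderings.  σ v a b  means  "a < b in σ_v"  (only its values on
-- neighbours a, b of v matter).

Ordering : Set₁
Ordering = Pt → Pt → Pt → Set

HomogeneousNorthSmallest : Ordering → Set₁
HomogeneousNorthSmallest σ =
  Σ (Dir → Dir → Set) λ _<ᵈ_ →
    IsStrictTotalOrder _≡_ _<ᵈ_ ×
    (∀ d → d ≢ N → N <ᵈ d) ×
    (∀ v d d' → (σ v (v +ᵖ vec d) (v +ᵖ vec d') ⇔ (d <ᵈ d')))

InSaw : List Dir → Set
InSaw ws =
  let m = length ws in
  (∀ i j → i < m → j < m → i ≢ j → pos ws i ≢ pos ws j) ×
  (2 ≤ m → pos ws m ≢ pos ws (m ∸ 2)) ×
  ((∀ i → i < m → pos ws m ≢ pos ws i) ⊎ (∃[ i ] (i < m × pos ws m ≡ pos ws i)))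

OccupiedLeaf : Ordering → List Dir → Set
OccupiedLeaf σ ws =
  let m = length ws in
  InSaw ws ×
  ∃[ i ] (i < m × pos ws m ≡ pos ws i ×
          σ (pos ws i) (pos ws (suc i)) (pos ws (m ∸ 1)))

UnoccupiedLeaf : Ordering → List Dir → Set
UnoccupiedLeaf σ ws =
  let m = length ws in
  InSaw ws ×
  ∃[ i ] (i < m × pos ws m ≡ pos ws i ×
          σ (pos ws i) (pos ws (m ∸ 1)) (pos ws (suc i)))

-- T^σ_saw(ℤ²): delete unoccupied leaves, and for each occupied leaf its
-- parent together with the whole subtree below it.
InSawσ : Ordering → List Dir → Set
InSawσ σ ws =
  InSaw ws ×
  ¬ UnoccupiedLeaf σ ws ×
  (∀ k d → k ≤ length ws → ¬ OccupiedLeaf σ (take k ws ∷ʳ d))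

-- Trees generated by state rules.  A node in state s has one child per
-- state s' listed in  children s , obtained by the step  step s' .

data Gen {St : Set} (step : St → Dir) (children : St → List St)
         : St → List Dir → Set where
  root  : ∀ {s} → Gen step children s []
  child : ∀ {s s' ws} → s' ∈ children s →
          Gen step children s' ws → Gen step children s (step s' ∷ ws)

data StH : Set where
  hO hN hE hW : StH

stepH : StH → Dir
stepH hO = N   -- irrelevant: the root state is never a child
stepH hN = N
stepH hE = E
stepH hW = W

childrenH : StH → List StH
childrenH hO = hN ∷ hE ∷ hW ∷ []
childrenH hN = hN ∷ hE ∷ hW ∷ []
childrenH hE = hN ∷ hE ∷ []
childrenH hW = hN ∷ hW ∷ []

InTDH : List Dir → Set
InTDH ws = Gen stepH childrenH hO ws

data St' : Set where
  sO sN sE sW sNN sNNE sNEE sEES sESE sSEE sEEN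
    sNNW sNWW sWWS sWSW sSWW sWWN : St'

step' : St' → Dir
step' sO   = N   -- irrelevant: the root state is never a child
step' sN   = N
step' sE   = E
step' sW   = W
step' sNN  = N
step' sNNE = E
step' sNEE = E
step' sEES = S
step' sESE = E
step' sSEE = E
step' sEEN = N
step' sNNW = W
step' sNWW = W
step' sWWS = S
step' sWSW = W
step' sSWW = W
step' sWWN = N

children' : St' → List St'
children' sO   = sN ∷ sE ∷ sW ∷ []
children' sN   = sE ∷ sW ∷ sNN ∷ []
children' sE   = sN ∷ sE ∷ []
children' sW   = sN ∷ sW ∷ []
children' sNN  = sNN ∷ sNNE ∷ sNNW ∷ []
children' sNNE = sN ∷ sNEE ∷ []
children' sNEE = sN ∷ sE ∷ sEES ∷ []
children' sEES = sESE ∷ []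
children' sESE = sSEE ∷ []
children' sSEE = sEEN ∷ []
children' sEEN = sN ∷ sE ∷ []
children' sNNW = sN ∷ sNWW ∷ []
children' sNWW = sN ∷ sW ∷ sWWS ∷ []
children' sWWS = sWSW ∷ []
children' sWSW = sSWW ∷ []
children' sSWW = sWWN ∷ []
children' sWWN = sN ∷ sW ∷ []

InTD' : List Dir → Set
InTD' ws = Gen step' children' sO ws

-- Every state of D_H is mimicked by a state of D' taking the same steps (N by N or NN, E by E,
-- NNE or NEE, and W symmetrically), so T_{D_H} ⊆ T_{D'}.
--
-- Along a walk of T_{D'}, the vertices visited before the current one, seen from the current
-- one, lie in a set determined by the current state: a lower half-plane, possibly with a ray of
-- the current row behind the walk, together with the few vertices of an unfinished detour
-- NNEESEEN or NNWWSWWN.  The current vertex is not in this set, so the walks are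
-- self-avoiding, and the only neighbours of the current vertex in it are the previous vertex
-- and its southern neighbour.  Hence every leaf hanging from a walk of T_{D'} closes a loop by
-- stepping S onto a vertex w, with v_{m-1} = w + N; as N is the σ_w-smallest direction, such
-- a leaf is unoccupied, and no walk of T_{D'} is cut out of T^σ_saw.
module Submission where

open import Defs
open import Data.Empty using (⊥; ⊥-elim)
open import Data.Integer as ℤ using (ℤ; +_; -[1+_]; 0ℤ; 1ℤ; -1ℤ; -≤-; +≤+) renaming (_+_ to _+ℤ_; _-_ to _-ℤ_)
import Data.Integer.Properties as ℤ
open import Data.Integer.Tactic.RingSolver using (solve-∀)
open import Data.List using (List; []; _∷_; _++_; _∷ʳ_; take; length)
open import Data.List.Properties using (length-++; length-take; take-all; ++-assoc; ++-identityʳ)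
open import Data.List.Membership.Propositional using (_∈_)
import Data.List.Membership.DecPropositional as DecMembership
open import Data.List.Relation.Unary.All as All using (All; []; _∷_; all?)
open import Data.List.Relation.Unary.Any using (here; there)
open import Data.Nat as ℕ using (zero; suc; _<_; _≤_; _∸_; z≤n; s≤s)
import Data.Nat.Properties as ℕ
open import Data.Product using (∃-syntax; _×_; _,_; proj₂)
open import Data.Product.Properties using (≡-dec)
open import Data.Sum using (_⊎_; inj₁; inj₂; [_,_]′)
open import Function.Base using (id)
open import Function.Bundles using (Equivalence)
open import Relation.Binary.Definitions using (DecidableEquality; tri<; tri≈; tri>)
open import Relation.Binary.PropositionalEquality
open import Relation.Binary.Structures using (IsStrictTotalOrder)
open import Relation.Nullary using (¬_; Dec; yes; no)
open import Relation.Nullary.Decidable using (True; toWitness; _⊎-dec_; _×-dec_; ¬?)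
open import Relation.Unary using (Decidable)

open DecMembership (≡-dec ℤ._≟_ ℤ._≟_) using (_∈?_)

pattern first  = here refl
pattern second = there (here refl)
pattern third  = there (there (here refl))

data Simulates : StH → St' → Set where
  O~O : Simulates hO sO
  N~N : Simulates hN sN
  N~NN : Simulates hN sNN
  E~E : Simulates hE sE
  E~NNE : Simulates hE sNNE
  E~NEE : Simulates hE sNEE
  W~W : Simulates hW sW
  W~NNW : Simulates hW sNNW
  W~NWW : Simulates hW sNWW

simulate-child : ∀ {h s h'} → Simulates h s → h' ∈ childrenH h →
                 ∃[ s' ] (s' ∈ children' s × Simulates h' s' × step' s' ≡ stepH h')
simulate-child O~O first = sN , first , N~N , refl
simulate-child O~O second = sE , second , E~E , refl
simulate-child O~O third = sW , third , W~W , refl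
simulate-child N~N first = sNN , third , N~NN , refl
simulate-child N~N second = sE , first , E~E , refl
simulate-child N~N third = sW , second , W~W , refl
simulate-child N~NN first = sNN , first , N~NN , refl
simulate-child N~NN second = sNNE , second , E~NNE , refl
simulate-child N~NN third = sNNW , third , W~NNW , refl
simulate-child E~E first = sN , first , N~N , refl
simulate-child E~E second = sE , second , E~E , refl
simulate-child E~NNE first = sN , first , N~N , refl
simulate-child E~NNE second = sNEE , second , E~NEE , refl
simulate-child E~NEE first = sN , first , N~N , refl
simulate-child E~NEE second = sE , second , E~E , refl
simulate-child W~W first = sN , first , N~N , refl
simulate-child W~W second = sW , second , W~W , refl
simulate-child W~NNW first = sN , first , N~N , refl
simulate-child W~NNW second = sNWW , second , W~NWW , refl
simulate-child W~NWW first = sN , first , N~N , refl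
simulate-child W~NWW second = sW , second , W~W , refl

simulate : ∀ {h s ws} → Simulates h s → Gen stepH childrenH h ws → Gen step' children' s ws
simulate sim root = root
simulate sim (child m g) with simulate-child sim m
... | s' , m' , sim' , same-step rewrite sym same-step = child m' (simulate sim' g)

TDH⊆TD' : ∀ ws → InTDH ws → InTD' ws
TDH⊆TD' ws = simulate O~O

_-ᵖ_ : Pt → Pt → Pt
(a , b) -ᵖ (c , d) = (a -ℤ c , b -ℤ d)

opposite : Dir → Dir
opposite N = S
opposite S = N
opposite E = W
opposite W = E

+ᵖ-assoc : ∀ a b c → (a +ᵖ b) +ᵖ c ≡ a +ᵖ (b +ᵖ c)
+ᵖ-assoc (a₁ , a₂) (b₁ , b₂) (c₁ , c₂) = cong₂ _,_ (ℤ.+-assoc a₁ b₁ c₁) (ℤ.+-assoc a₂ b₂ c₂)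

+ᵖ-comm : ∀ a b → a +ᵖ b ≡ b +ᵖ a
+ᵖ-comm (a₁ , a₂) (b₁ , b₂) = cong₂ _,_ (ℤ.+-comm a₁ b₁) (ℤ.+-comm a₂ b₂)

+ᵖ-identityʳ : ∀ a → a +ᵖ origin ≡ a
+ᵖ-identityʳ (a₁ , a₂) = cong₂ _,_ (ℤ.+-identityʳ a₁) (ℤ.+-identityʳ a₂)

v-[c+t]≡v-c-t : ∀ v c t → v -ᵖ (c +ᵖ t) ≡ (v -ᵖ c) -ᵖ t
v-[c+t]≡v-c-t (v₁ , v₂) (c₁ , c₂) (t₁ , t₂) = cong₂ _,_ (lemma v₁ c₁ t₁) (lemma v₂ c₂ t₂)
  where
  lemma : ∀ v c t → v -ℤ (c +ℤ t) ≡ (v -ℤ c) -ℤ t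
  lemma = solve-∀

v-v≡origin : ∀ c → c -ᵖ c ≡ origin
v-v≡origin (c₁ , c₂) = cong₂ _,_ (ℤ.+-inverseʳ c₁) (ℤ.+-inverseʳ c₂)

[c+t]-c≡t : ∀ c t → (c +ᵖ t) -ᵖ c ≡ t
[c+t]-c≡t (c₁ , c₂) (t₁ , t₂) = cong₂ _,_ (lemma c₁ t₁) (lemma c₂ t₂)
  where
  lemma : ∀ c t → (c +ℤ t) -ℤ c ≡ t
  lemma = solve-∀

vec-opposite : ∀ d → vec d +ᵖ vec (opposite d) ≡ origin
vec-opposite N = refl
vec-opposite S = refl
vec-opposite E = refl
vec-opposite W = refl

step-back : ∀ v d → (v +ᵖ vec d) +ᵖ vec (opposite d) ≡ v
step-back v d = trans (+ᵖ-assoc v (vec d) (vec (opposite d)))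
                      (trans (cong (v +ᵖ_) (vec-opposite d)) (+ᵖ-identityʳ v))

vec≢origin : ∀ d → vec d ≢ origin
vec≢origin N ()
vec≢origin S ()
vec≢origin E ()
vec≢origin W ()

step-moves : ∀ v d → v +ᵖ vec d ≢ v
step-moves v d eq = vec≢origin d (begin
  vec d              ≡⟨ sym ([c+t]-c≡t v (vec d)) ⟩
  (v +ᵖ vec d) -ᵖ v  ≡⟨ cong (_-ᵖ v) eq ⟩
  v -ᵖ v             ≡⟨ v-v≡origin v ⟩
  origin             ∎)
  where open ≡-Reasoning

take-++ : ∀ {A : Set} (xs ys : List A) {i} → i ≤ length xs → take i (xs ++ ys) ≡ take i xs
take-++ xs       ys {zero}  _       = refl
take-++ (x ∷ xs) ys {suc i} (s≤s h) = cong (x ∷_) (take-++ xs ys h)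

take-take : ∀ {A : Set} (xs : List A) {i j} → i ≤ j → take i (take j xs) ≡ take i xs
take-take xs       {zero}          _       = refl
take-take []       {suc i} {suc j} _       = refl
take-take (x ∷ xs) {suc i} {suc j} (s≤s h) = cong (x ∷_) (take-take xs h)

length-∷ʳ : ∀ {A : Set} (xs : List A) x → length (xs ∷ʳ x) ≡ suc (length xs)
length-∷ʳ xs x = trans (length-++ xs) (ℕ.+-comm (length xs) 1)

endpoint-∷ʳ : ∀ ws d → endpoint (ws ∷ʳ d) ≡ endpoint ws +ᵖ vec d
endpoint-∷ʳ []       d = +ᵖ-comm (vec d) origin
endpoint-∷ʳ (x ∷ ws) d = trans (cong (vec x +ᵖ_) (endpoint-∷ʳ ws d)) (sym (+ᵖ-assoc (vec x) _ (vec d)))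

pos-length : ∀ ws → pos ws (length ws) ≡ endpoint ws
pos-length ws = cong endpoint (take-all (length ws) ws ℕ.≤-refl)

pos-take : ∀ ws {i j} → i ≤ j → pos (take j ws) i ≡ pos ws i
pos-take ws h = cong endpoint (take-take ws h)

pos-∷ʳ : ∀ ws d {i} → i ≤ length ws → pos (ws ∷ʳ d) i ≡ pos ws i
pos-∷ʳ ws d h = cong endpoint (take-++ ws (d ∷ []) h)

pos-∷ʳ-end : ∀ ws d → pos (ws ∷ʳ d) (suc (length ws)) ≡ endpoint ws +ᵖ vec d
pos-∷ʳ-end ws d = begin
  pos (ws ∷ʳ d) (suc (length ws))    ≡⟨ cong (pos (ws ∷ʳ d)) (sym (length-∷ʳ ws d)) ⟩
  pos (ws ∷ʳ d) (length (ws ∷ʳ d))   ≡⟨ pos-length (ws ∷ʳ d) ⟩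
  endpoint (ws ∷ʳ d)                 ≡⟨ endpoint-∷ʳ ws d ⟩
  endpoint ws +ᵖ vec d               ∎
  where open ≡-Reasoning

relative-∷ʳ : ∀ ws d {i} → i ≤ length ws →
              pos (ws ∷ʳ d) i -ᵖ endpoint (ws ∷ʳ d) ≡ (pos ws i -ᵖ endpoint ws) -ᵖ vec d
relative-∷ʳ ws d {i} h = trans (cong₂ _-ᵖ_ (pos-∷ʳ ws d h) (endpoint-∷ʳ ws d)) (v-[c+t]≡v-c-t (pos ws i) (endpoint ws) (vec d))

pos-suc : ∀ ws {i} → i < length ws → ∃[ f ] (pos ws (suc i) ≡ pos ws i +ᵖ vec f)
pos-suc (d ∷ ws) {zero}  _       = d , +ᵖ-comm (vec d) origin
pos-suc (d ∷ ws) {suc i} (s≤s h) with pos-suc ws h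
... | f , eq = f , trans (cong (vec d +ᵖ_) eq) (sym (+ᵖ-assoc (vec d) (pos ws i) (vec f)))

SelfAvoiding : List Dir → Set
SelfAvoiding ws = ∀ {i j} → i < j → j ≤ length ws → pos ws i ≢ pos ws j

self-avoiding⇒InSaw : ∀ {ws} → SelfAvoiding ws → InSaw ws
self-avoiding⇒InSaw {ws} sa = distinct , no-backtrack , inj₁ (λ i i<m eq → sa i<m ℕ.≤-refl (sym eq))
  where
  m = length ws
  distinct : ∀ i j → i < m → j < m → i ≢ j → pos ws i ≢ pos ws j
  distinct i j i<m j<m i≢j with ℕ.<-cmp i j
  ... | tri< i<j _ _ = sa i<j (ℕ.<⇒≤ j<m)
  ... | tri≈ _ i≡j _ = ⊥-elim (i≢j i≡j)
  ... | tri> _ _ j<i = λ eq → sa j<i (ℕ.<⇒≤ i<m) (sym eq)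
  no-backtrack : 2 ≤ m → pos ws m ≢ pos ws (m ∸ 2)
  no-backtrack 2≤m eq = sa (ℕ.∸-monoʳ-< {o = 0} (s≤s z≤n) 2≤m) ℕ.≤-refl (sym eq)

self-avoiding⇒¬UnoccupiedLeaf : ∀ σ {ws} → SelfAvoiding ws → ¬ UnoccupiedLeaf σ ws
self-avoiding⇒¬UnoccupiedLeaf σ sa (_ , i , i<m , eq , _) = sa i<m ℕ.≤-refl (sym eq)

-2ℤ -3ℤ -4ℤ 2ℤ 3ℤ 4ℤ : ℤ
-2ℤ = -[1+ 1 ]
-3ℤ = -[1+ 2 ]
-4ℤ = -[1+ 3 ]
2ℤ = + 2
3ℤ = + 3
4ℤ = + 4

data Ray : Set where
  x≤-1 x≤-2 x≥1 x≥2 : Ray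

data Region : Set where
  ∅ y≤-1 y≤-2 : Region
  y≤-1∪y≡0∧ : Ray → Region

OnRay : Ray → ℤ → Set
OnRay x≤-1 x = x ℤ.≤ -1ℤ
OnRay x≤-2 x = x ℤ.≤ -2ℤ
OnRay x≥1  x = 1ℤ ℤ.≤ x
OnRay x≥2  x = 2ℤ ℤ.≤ x

InRegion : Region → Pt → Set
InRegion ∅               _       = ⊥
InRegion y≤-1            (x , y) = y ℤ.≤ -1ℤ
InRegion y≤-2            (x , y) = y ℤ.≤ -2ℤ
InRegion (y≤-1∪y≡0∧ ray) (x , y) = y ℤ.≤ -1ℤ ⊎ (y ≡ 0ℤ × OnRay ray x)

region : St' → Region
region sO   = ∅
region sN   = y≤-1
region sE   = y≤-1∪y≡0∧ x≤-1
region sW   = y≤-1∪y≡0∧ x≥1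
region sNN  = y≤-2
region sNNE = y≤-2
region sNEE = y≤-2
region sEES = y≤-1
region sESE = y≤-1
region sSEE = y≤-1
region sEEN = y≤-1∪y≡0∧ x≤-2
region sNNW = y≤-2
region sNWW = y≤-2
region sWWS = y≤-1
region sWSW = y≤-1
region sSWW = y≤-1
region sWWN = y≤-1∪y≡0∧ x≥2

-- The vertices of an unfinished detour NNEESEEN (or its mirror image) that lie outside the
-- region, relative to the current vertex.
detour : St' → List Pt
detour sNN  = (0ℤ , -1ℤ) ∷ []
detour sNNE = (-1ℤ , -1ℤ) ∷ (-1ℤ , 0ℤ) ∷ []
detour sNEE = (-2ℤ , -1ℤ) ∷ (-2ℤ , 0ℤ) ∷ (-1ℤ , 0ℤ) ∷ []
detour sEES = (-2ℤ , 0ℤ) ∷ (-2ℤ , 1ℤ) ∷ (-1ℤ , 1ℤ) ∷ (0ℤ , 1ℤ) ∷ []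
detour sESE = (-3ℤ , 0ℤ) ∷ (-3ℤ , 1ℤ) ∷ (-2ℤ , 1ℤ) ∷ (-1ℤ , 1ℤ) ∷ (-1ℤ , 0ℤ) ∷ []
detour sSEE = (-4ℤ , 0ℤ) ∷ (-4ℤ , 1ℤ) ∷ (-3ℤ , 1ℤ) ∷ (-2ℤ , 1ℤ) ∷ (-2ℤ , 0ℤ) ∷ (-1ℤ , 0ℤ) ∷ []
detour sNNW = (1ℤ , -1ℤ) ∷ (1ℤ , 0ℤ) ∷ []
detour sNWW = (2ℤ , -1ℤ) ∷ (2ℤ , 0ℤ) ∷ (1ℤ , 0ℤ) ∷ []
detour sWWS = (2ℤ , 0ℤ) ∷ (2ℤ , 1ℤ) ∷ (1ℤ , 1ℤ) ∷ (0ℤ , 1ℤ) ∷ []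
detour sWSW = (3ℤ , 0ℤ) ∷ (3ℤ , 1ℤ) ∷ (2ℤ , 1ℤ) ∷ (1ℤ , 1ℤ) ∷ (1ℤ , 0ℤ) ∷ []
detour sSWW = (4ℤ , 0ℤ) ∷ (4ℤ , 1ℤ) ∷ (3ℤ , 1ℤ) ∷ (2ℤ , 1ℤ) ∷ (2ℤ , 0ℤ) ∷ (1ℤ , 0ℤ) ∷ []
detour _    = []

Occupied : St' → Pt → Set
Occupied s r = InRegion (region s) r ⊎ r ∈ detour s

onRay? : ∀ ray → Decidable (OnRay ray)
onRay? x≤-1 x = x ℤ.≤? -1ℤ
onRay? x≤-2 x = x ℤ.≤? -2ℤ
onRay? x≥1  x = 1ℤ ℤ.≤? x
onRay? x≥2  x = 2ℤ ℤ.≤? x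

inRegion? : ∀ R → Decidable (InRegion R)
inRegion? ∅               _       = no λ ()
inRegion? y≤-1            (x , y) = y ℤ.≤? -1ℤ
inRegion? y≤-2            (x , y) = y ℤ.≤? -2ℤ
inRegion? (y≤-1∪y≡0∧ ray) (x , y) = y ℤ.≤? -1ℤ ⊎-dec (y ℤ.≟ 0ℤ ×-dec onRay? ray x)

occupied? : ∀ s → Decidable (Occupied s)
occupied? s r = inRegion? (region s) r ⊎-dec r ∈? detour s

pattern ≤-1 = -≤- z≤n
pattern ≤-2 = -≤- (s≤s z≤n)
pattern ≥1  = +≤+ (s≤s z≤n)
pattern ≥2  = +≤+ (s≤s (s≤s z≤n))

-- Matching on the canonical ≤-proofs exposes the coordinates as constructors, so the shifted
-- coordinates compute and each case is closed by a canonical proof again.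
region-shift : ∀ {s s'} → s' ∈ children' s → ∀ {x y} →
               InRegion (region s) (x , y) → InRegion (region s') ((x , y) -ᵖ vec (step' s'))
region-shift {sN}   first  ≤-1                 = inj₁ ≤-1
region-shift {sN}   second ≤-1                 = inj₁ ≤-1
region-shift {sN}   third  ≤-1                 = ≤-2
region-shift {sE}   first  (inj₁ ≤-1)          = ≤-1
region-shift {sE}   first  (inj₂ (refl , _))   = ≤-1
region-shift {sE}   second (inj₁ ≤-1)          = inj₁ ≤-1
region-shift {sE}   second (inj₂ (refl , ≤-1)) = inj₂ (refl , ≤-1)
region-shift {sW}   first  (inj₁ ≤-1)          = ≤-1
region-shift {sW}   first  (inj₂ (refl , _))   = ≤-1
region-shift {sW}   second (inj₁ ≤-1)          = inj₁ ≤-1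
region-shift {sW}   second (inj₂ (refl , ≥1))  = inj₂ (refl , ≥1)
region-shift {sNN}  first  ≤-2                 = ≤-2
region-shift {sNN}  second ≤-2                 = ≤-2
region-shift {sNN}  third  ≤-2                 = ≤-2
region-shift {sNNE} first  ≤-2                 = ≤-1
region-shift {sNNE} second ≤-2                 = ≤-2
region-shift {sNEE} first  ≤-2                 = ≤-1
region-shift {sNEE} second ≤-2                 = inj₁ ≤-1
region-shift {sNEE} third  ≤-2                 = ≤-1
region-shift {sEES} first  ≤-1                 = ≤-1
region-shift {sESE} first  ≤-1                 = ≤-1
region-shift {sSEE} first  ≤-1                 = inj₁ ≤-1
region-shift {sEEN} first  (inj₁ ≤-1)          = ≤-1
region-shift {sEEN} first  (inj₂ (refl , _))   = ≤-1
region-shift {sEEN} second (inj₁ ≤-1)          = inj₁ ≤-1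
region-shift {sEEN} second (inj₂ (refl , ≤-2)) = inj₂ (refl , ≤-1)
region-shift {sNNW} first  ≤-2                 = ≤-1
region-shift {sNNW} second ≤-2                 = ≤-2
region-shift {sNWW} first  ≤-2                 = ≤-1
region-shift {sNWW} second ≤-2                 = inj₁ ≤-1
region-shift {sNWW} third  ≤-2                 = ≤-1
region-shift {sWWS} first  ≤-1                 = ≤-1
region-shift {sWSW} first  ≤-1                 = ≤-1
region-shift {sSWW} first  ≤-1                 = inj₁ ≤-1
region-shift {sWWN} first  (inj₁ ≤-1)          = ≤-1
region-shift {sWWN} first  (inj₂ (refl , _))   = ≤-1
region-shift {sWWN} second (inj₁ ≤-1)          = inj₁ ≤-1
region-shift {sWWN} second (inj₂ (refl , ≥2))  = inj₂ (refl , ≥1)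

allStates : List St'
allStates = sO ∷ sN ∷ sE ∷ sW ∷ sNN ∷ sNNE ∷ sNEE ∷ sEES ∷ sESE ∷ sSEE ∷ sEEN
          ∷ sNNW ∷ sNWW ∷ sWWS ∷ sWSW ∷ sSWW ∷ sWWN ∷ []

all-states : ∀ {P : St' → Set} → All P allStates → ∀ s → P s
all-states (o ∷ n ∷ e ∷ w ∷ nn ∷ nne ∷ nee ∷ ees ∷ ese ∷ see ∷ een ∷ nnw ∷ nww ∷ wws ∷ wsw ∷ sww ∷ wwn ∷ []) =
  λ { sO → o ; sN → n ; sE → e ; sW → w ; sNN → nn ; sNNE → nne ; sNEE → nee ; sEES → ees
    ; sESE → ese ; sSEE → see ; sEEN → een ; sNNW → nnw ; sNWW → nww ; sWWS → wws
    ; sWSW → wsw ; sSWW → sww ; sWWN → wwn }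

decide-all-states : ∀ {P : St' → Set} (P? : Decidable P) → {True (all? P? allStates)} → ∀ s → P s
decide-all-states P? {ok} = all-states (toWitness ok)

all-dirs : ∀ {P : Dir → Set} → All P (N ∷ S ∷ E ∷ W ∷ []) → ∀ d → P d
all-dirs (n ∷ s ∷ e ∷ w ∷ []) = λ { N → n ; S → s ; E → e ; W → w }

_≟ᵈ_ : DecidableEquality Dir
N ≟ᵈ N = yes refl
S ≟ᵈ S = yes refl
E ≟ᵈ E = yes refl
W ≟ᵈ W = yes refl
N ≟ᵈ S = no λ ()
N ≟ᵈ E = no λ ()
N ≟ᵈ W = no λ ()
S ≟ᵈ N = no λ ()
S ≟ᵈ E = no λ ()
S ≟ᵈ W = no λ ()
E ≟ᵈ N = no λ ()
E ≟ᵈ S = no λ ()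
E ≟ᵈ W = no λ ()
W ≟ᵈ N = no λ ()
W ≟ᵈ S = no λ ()
W ≟ᵈ E = no λ ()

decide-children : ∀ {P : St' → St' → Set} (P? : ∀ s s' → Dec (P s s')) →
                  {True (all? (λ s → all? (P? s) (children' s)) allStates)} →
                  ∀ {s s'} → s' ∈ children' s → P s s'
decide-children P? {ok} {s} = All.lookup (decide-all-states (λ s → all? (P? s) (children' s)) {ok} s)

detour-shift : ∀ {s s'} → s' ∈ children' s → ∀ {r} → r ∈ detour s → Occupied s' (r -ᵖ vec (step' s'))
detour-shift m = All.lookup (decide-children (λ s s' → all? (λ r → occupied? s' (r -ᵖ vec (step' s'))) (detour s)) m)

left-vertex-occupied : ∀ {s s'} → s' ∈ children' s → Occupied s' (origin -ᵖ vec (step' s'))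
left-vertex-occupied = decide-children (λ _ s' → occupied? s' (origin -ᵖ vec (step' s')))

origin-unoccupied : ∀ s → ¬ Occupied s origin
origin-unoccupied = decide-all-states λ s → ¬? (occupied? s origin)

occupied-neighbour : ∀ s e → Occupied s (vec e) → e ≡ S ⊎ e ≡ opposite (step' s)
occupied-neighbour s e occ = [ (λ free → ⊥-elim (free occ)) , id ]′ (all-dirs (checked s) e)
  where
  checked : ∀ s → All (λ e → ¬ Occupied s (vec e) ⊎ e ≡ S ⊎ e ≡ opposite (step' s)) (N ∷ S ∷ E ∷ W ∷ [])
  checked = decide-all-states λ s →
    all? (λ e → ¬? (occupied? s (vec e)) ⊎-dec (e ≟ᵈ S ⊎-dec e ≟ᵈ opposite (step' s))) (N ∷ S ∷ E ∷ W ∷ [])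

occupied-shift : ∀ {s s'} → s' ∈ children' s → ∀ r → Occupied s r → Occupied s' (r -ᵖ vec (step' s'))
occupied-shift m r (inj₁ inR) = inj₁ (region-shift m inR)
occupied-shift m r (inj₂ r∈)  = detour-shift m r∈

-- Reaches s u: the walk u is a node of T_{D'}, in state s (whereas Gen describes the subtree
-- below a node).
data Reaches : St' → List Dir → Set where
  start  : Reaches sO []
  extend : ∀ {s s' u} → Reaches s u → s' ∈ children' s → Reaches s' (u ∷ʳ step' s')

reaches-prefix : ∀ {s u ws} → Reaches s u → Gen step' children' s ws →
                 ∀ {k} → k ≤ length ws → ∃[ t ] Reaches t (u ++ take k ws)
reaches-prefix {s} {u} r _ {zero} _ = s , subst (Reaches s) (sym (++-identityʳ u)) r
reaches-prefix {u = u} r (child {s' = s'} {ws = ws} m g) {suc k} (s≤s k≤) with reaches-prefix (extend r m) g k≤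
... | t , r' = t , subst (Reaches t) (++-assoc u (step' s' ∷ []) (take k ws)) r'

TD'-prefix : ∀ {ws} → InTD' ws → ∀ {k} → k ≤ length ws → ∃[ s ] Reaches s (take k ws)
TD'-prefix = reaches-prefix start

occupied-behind : ∀ {s u} → Reaches s u → ∀ {i} → i < length u → Occupied s (pos u i -ᵖ endpoint u)
occupied-behind (extend {s' = s'} {u = u} r m) {i} i< rewrite length-∷ʳ u (step' s')
  with ℕ.m≤n⇒m<n∨m≡n (ℕ.≤-pred i<)
... | inj₁ i<L = subst (Occupied s') (sym (relative-∷ʳ u (step' s') (ℕ.<⇒≤ i<L)))
                       (occupied-shift m _ (occupied-behind r i<L))
... | inj₂ refl = subst (Occupied s') (sym (begin
  pos (u ∷ʳ step' s') (length u) -ᵖ endpoint (u ∷ʳ step' s') ≡⟨ relative-∷ʳ u (step' s') ℕ.≤-refl ⟩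
  (pos u (length u) -ᵖ endpoint u) -ᵖ vec (step' s')         ≡⟨ cong (λ c → (c -ᵖ endpoint u) -ᵖ vec (step' s')) (pos-length u) ⟩
  (endpoint u -ᵖ endpoint u) -ᵖ vec (step' s')               ≡⟨ cong (_-ᵖ vec (step' s')) (v-v≡origin (endpoint u)) ⟩
  origin -ᵖ vec (step' s')                                   ∎)) (left-vertex-occupied m)
  where open ≡-Reasoning

endpoint-fresh : ∀ {s u} → Reaches s u → ∀ {i} → i < length u → pos u i ≢ endpoint u
endpoint-fresh {s} {u} r i< eq = origin-unoccupied s
  (subst (Occupied s) (trans (cong (_-ᵖ endpoint u) eq) (v-v≡origin (endpoint u))) (occupied-behind r i<))

TD'-self-avoiding : ∀ {ws} → InTD' ws → SelfAvoiding ws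
TD'-self-avoiding {ws} g {i} {j} i<j j≤ eq with TD'-prefix g j≤
... | s , r = endpoint-fresh r i<j′ (begin
  pos (take j ws) i          ≡⟨ pos-take ws (ℕ.<⇒≤ i<j) ⟩
  pos ws i                   ≡⟨ eq ⟩
  pos ws j                   ≡⟨ sym (pos-take ws ℕ.≤-refl) ⟩
  pos (take j ws) j          ≡⟨ cong (pos (take j ws)) (sym length-take-j) ⟩
  pos (take j ws) (length (take j ws)) ≡⟨ pos-length (take j ws) ⟩
  endpoint (take j ws)       ∎)
  where
  open ≡-Reasoning
  length-take-j : length (take j ws) ≡ j
  length-take-j = trans (length-take j ws) (ℕ.m≤n⇒m⊓n≡m j≤)
  i<j′ : i < length (take j ws)
  i<j′ = subst (i <_) (sym length-take-j) i<j

last-step : ∀ {s u} → Reaches s u → 0 < length u → pos u (length u ∸ 1) +ᵖ vec (step' s) ≡ endpoint u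
last-step (extend {s' = s'} {u = u} r m) _ rewrite length-∷ʳ u (step' s') =
  trans (cong (_+ᵖ vec (step' s')) (trans (pos-∷ʳ u (step' s') ℕ.≤-refl) (pos-length u)))
        (sym (endpoint-∷ʳ u (step' s')))

neighbour-revisit : ∀ {s u} → Reaches s u → ∀ {i e} → i < length u → pos u i ≡ endpoint u +ᵖ vec e →
                    e ≡ S ⊎ e ≡ opposite (step' s)
neighbour-revisit {s} {u} r {i} {e} i< eq = occupied-neighbour s e
  (subst (Occupied s) (trans (cong (_-ᵖ endpoint u) eq) ([c+t]-c≡t (endpoint u) (vec e))) (occupied-behind r i<))

north-not-above : ∀ σ → HomogeneousNorthSmallest σ → ∀ v f → ¬ σ v (v +ᵖ vec f) (v +ᵖ vec N)
north-not-above σ (_<ᵈ_ , sto , N-least , homogeneous) v f σ-f<N =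
  nothing-below-N f (Equivalence.to (homogeneous v f N) σ-f<N)
  where
  open IsStrictTotalOrder sto using (irrefl) renaming (trans to <-trans)
  nothing-below-N : ∀ f → ¬ f <ᵈ N
  nothing-below-N f f<N with f ≟ᵈ N
  ... | yes refl = irrefl refl f<N
  ... | no f≢N = irrefl refl (<-trans f<N (N-least f f≢N))

no-occupied-leaf : ∀ σ → HomogeneousNorthSmallest σ → ∀ {s u} → Reaches s u → ∀ e → ¬ OccupiedLeaf σ (u ∷ʳ e)
no-occupied-leaf σ hyp {s} {u} r e ((_ , no-backtrack , _) , i , i< , closes , order)
  rewrite length-∷ʳ u e | pos-∷ʳ-end u e
  with ℕ.m≤n⇒m<n∨m≡n (ℕ.≤-pred i<)
... | inj₂ refl = step-moves (endpoint u) e (trans closes (trans (pos-∷ʳ u e ℕ.≤-refl) (pos-length u)))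
... | inj₁ i<L with neighbour-revisit r {e = e} i<L (sym (trans closes (pos-∷ʳ u e (ℕ.<⇒≤ i<L))))
...   | inj₂ refl = no-backtrack (s≤s 1≤L) (begin
  endpoint u +ᵖ vec (opposite (step' s))                    ≡⟨ cong (λ c → c +ᵖ vec (opposite (step' s))) (sym (last-step r 1≤L)) ⟩
  (pos u (L ∸ 1) +ᵖ vec (step' s)) +ᵖ vec (opposite (step' s)) ≡⟨ step-back (pos u (L ∸ 1)) (step' s) ⟩
  pos u (L ∸ 1)                                             ≡⟨ sym (pos-∷ʳ u e (ℕ.m∸n≤m L 1)) ⟩
  pos (u ∷ʳ e) (L ∸ 1)                                      ∎)
  where
  open ≡-Reasoning
  L = length u
  1≤L = ℕ.≤-trans (s≤s z≤n) i<L
...   | inj₁ refl with pos-suc (u ∷ʳ e) (subst (i <_) (sym (length-∷ʳ u e)) i<)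
...     | f , next = north-not-above σ hyp v f (subst₂ (σ v) next previous order)
  where
  v = pos (u ∷ʳ e) i
  previous : pos (u ∷ʳ e) (length u) ≡ v +ᵖ vec N
  previous = begin
    pos (u ∷ʳ e) (length u)            ≡⟨ trans (pos-∷ʳ u e ℕ.≤-refl) (pos-length u) ⟩
    endpoint u                         ≡⟨ sym (step-back (endpoint u) S) ⟩
    (endpoint u +ᵖ vec S) +ᵖ vec N     ≡⟨ cong (_+ᵖ vec N) closes ⟩
    v +ᵖ vec N                         ∎
    where open ≡-Reasoning

TD'⊆Tσsaw : ∀ σ → HomogeneousNorthSmallest σ → ∀ ws → InTD' ws → InSawσ σ ws
TD'⊆Tσsaw σ hyp ws g =
  self-avoiding⇒InSaw sa , self-avoiding⇒¬UnoccupiedLeaf σ sa ,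
  λ k d k≤ → no-occupied-leaf σ hyp (proj₂ (TD'-prefix g k≤)) d
  where sa = TD'-self-avoiding g

lemma10 : (σ : Ordering) → HomogeneousNorthSmallest σ →
          (∀ (ws : List Dir) → InTDH ws → InTD' ws) ×
          (∀ (ws : List Dir) → InTD' ws → InSawσ σ ws)
lemma10 σ hyp = TDH⊆TD' , TD'⊆Tσsaw σ hyp
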